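{- Let $k$ be a positive integer and $n=4k^2$. The number of ample subsets $X\subseteq[n]$ (with respect to $\pi_n$, as defined in the context) is greater than \[ 2^n \left(1 - \frac{4\sqrt{n}}{2^{\sqrt{n}/2}} \right). \]
   Context: Let $k\ge 1$, $n=4k^2$, and let $\pi_n$ be the permutation of $[n]$ given by $\pi_n(2k(j-1)+i)=2ki-j+1$ for $i,j\in\{1,\dots,2k\}$; equivalently, in one-line notation $\pi_n = s\,(s-1)\,(s-2)\cdots(s-2k+1)$ where $s$ is the sequence $2k,4k,6k,\dots,4k^2$ and $s-i$ is obtained by subtracting $i$ from each term. Identify the index $2k(j-1)+i$ with the grid cell in column $j$ and row $i$ of a $2k\times 2k$ grid, so a subset $X\subseteq[n]$ corresponds to a $2k\times 2k$ 0-1 matrix $M_X$ whose $1$-entries are the cells of elements of $X$. Split the column set into $C_1=\{1,\dots,k\}$, $C_2=\{k+1,\dots,2k\}$ and the row set into $R_1=\{1,\dots,k\}$, $R_2=\{k+1,\dots,2k\}$, giving four $k\times k$ corner submatrices $C_a\times R_b$. The subset $X$ (or $M_X$) is called ample if each of the four corner submatrices has no zero row and no zero column, i.e. for every $a,b\in\{1,2\}$, every row in $R_b$ contains a cell of $X$ lying in a column of $C_a$, and every column in $C_a$ contains a cell of $X$ lying in a row of $R_b$. -}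

module Defs where

open import Data.Nat using (ℕ; zero; suc; _+_; _*_; _<_; _≤_; _<?_; _≤?_)
open import Data.Fin using (Fin; toℕ; combine)
open import Data.Fin.Subset using (Subset; _∈_)
open import Data.Fin.Properties using (all?; any?)
open import Data.Fin.Subset.Properties using (_∈?_)
open import Data.Bool using (Bool; true; false)
open import Data.Vec using (Vec; []; _∷_)
open import Data.List using (List; []; _∷_; map; _++_; filter; length)
open import Data.Product using (_×_; ∃)
open import Relation.Nullary using (Dec)
open import Relation.Nullary.Decidable using (_×-dec_; _→-dec_)

side : ℕ → ℕ
side k = k + k

-- The cell in column j and row i of the (2k)×(2k) grid (0-based i, j) is the
-- element with 0-based index  2k·j + i  of [n], n = 2k·2k = 4k²
-- (i.e. 1-based index 2k(j-1)+i with 1-based i, j).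
cell : (k : ℕ) → (i j : Fin (side k)) → Fin (side k * side k)
cell k i j = combine j i

-- Halves of the row/column index set: half 0 = {1..k}, half 1 = {k+1..2k}
-- (C₁ / R₁ and C₂ / R₂ respectively).
InHalf : (k : ℕ) → Fin 2 → Fin (side k) → Set
InHalf k Fin.zero    i = toℕ i < k
InHalf k (Fin.suc _) i = k ≤ toℕ i

Ample : (k : ℕ) → Subset (side k * side k) → Set
Ample k X = (a b : Fin 2) →
    ((i : Fin (side k)) → InHalf k b i → ∃ λ j → InHalf k a j × (cell k i j ∈ X))
  × ((j : Fin (side k)) → InHalf k a j → ∃ λ i → InHalf k b i × (cell k i j ∈ X))

InHalf? : (k : ℕ) → (h : Fin 2) → (i : Fin (side k)) → Dec (InHalf k h i)
InHalf? k Fin.zero    i = suc (toℕ i) ≤? k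
InHalf? k (Fin.suc _) i = k ≤? toℕ i

Ample? : (k : ℕ) → (X : Subset (side k * side k)) → Dec (Ample k X)
Ample? k X = all? λ a → all? λ b →
    (all? λ i → InHalf? k b i →-dec any? λ j → InHalf? k a j ×-dec (cell k i j ∈? X))
  ×-dec
    (all? λ j → InHalf? k a j →-dec any? λ i → InHalf? k b i ×-dec (cell k i j ∈? X))

allSubsets : (m : ℕ) → List (Subset m)
allSubsets zero    = [] ∷ []
allSubsets (suc m) = map (true ∷_) (allSubsets m) ++ map (false ∷_) (allSubsets m)

numAmple : ℕ → ℕ
numAmple k = length (filter (Ample? k) (allSubsets (side k * side k)))

-- Union bound. Fix halves a, b and a line of the grid (one of the k rows of R_b, or one of
-- the k columns of C_a); the event that X misses the k cells where this line meets the
-- corner block C_a × R_b contains exactly 2^n / 2^k subsets. There are 2·2·k·2 = 8k such events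
-- and X is ample precisely when none occurs, so at most 8k · 2^n / 2^k subsets are not ample.
-- The inequality is strict because the empty set, which is not ample, lies in at least two events.
module Submission where

open import Defs
open import Data.Nat using (ℕ; zero; suc; _+_; _*_; _^_; _<_; _≤_; z≤n; s≤s; _∸_)
open import Data.Nat.Properties
open import Data.Nat.Solver using (module +-*-Solver)
open import Algebra.Properties.CommutativeSemigroup +-commutativeSemigroup using (interchange)
open import Data.Bool using (Bool; true; false; if_then_else_)
open import Data.Fin using (Fin; toℕ; _↑ˡ_; _↑ʳ_; fromℕ<)
open import Data.Fin.Properties
  using (¬∀⟶∃¬; all?; any?; toℕ-injective; toℕ-↑ˡ; toℕ-↑ʳ; ↑ˡ-injective; ↑ʳ-injective;
         toℕ<n; toℕ-fromℕ<; combine-injective)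
import Data.Fin.Properties as Finₚ
open import Data.Fin.Subset using (Subset; _∈_; _∉_) renaming (⊥ to ∅)
open import Data.Fin.Subset.Properties using (_∈?_; ∉⊥)
open import Data.Vec using ([]; _∷_; lookup)
open import Data.Vec.Properties using (lookup⇒[]=)
open import Data.List using (List; []; _∷_; map; _++_; filter; length; allFin)
open import Data.List.Properties using (length-tabulate)
open import Data.List.Relation.Unary.Any using (here; there)
open import Data.List.Membership.Propositional using () renaming (_∈_ to _∈ˡ_)
open import Data.List.Membership.Propositional.Properties using (∈-map⁺; ∈-++⁺ˡ; ∈-++⁺ʳ; ∈-allFin)
open import Data.Product using (∃; _×_; _,_; proj₁; proj₂)
open import Relation.Nullary using (¬_; Dec; yes; no; does; ¬?; contradiction)
open import Relation.Nullary.Decidable using (_×-dec_; _→-dec_)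
open import Relation.Binary.PropositionalEquality
open import Function using (_∘_; id)
open import Function.Definitions using (Injective)

private
  variable
    I I′ : Set

∑ : List I → (I → ℕ) → ℕ
∑ []       f = 0
∑ (x ∷ xs) f = f x + ∑ xs f

syntax ∑ xs (λ x → e) = ∑[ x ∈ xs ] e

∑-++ : ∀ (xs ys : List I) f → ∑ (xs ++ ys) f ≡ ∑ xs f + ∑ ys f
∑-++ []       ys f = refl
∑-++ (x ∷ xs) ys f = trans (cong (f x +_) (∑-++ xs ys f)) (sym (+-assoc (f x) _ _))

∑-map : ∀ (g : I′ → I) xs f → ∑ (map g xs) f ≡ ∑ xs (f ∘ g)
∑-map g []       f = refl
∑-map g (x ∷ xs) f = cong (f (g x) +_) (∑-map g xs f)

∑-+ : ∀ (xs : List I) f g → ∑[ x ∈ xs ] (f x + g x) ≡ ∑ xs f + ∑ xs g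
∑-+ []       f g = refl
∑-+ (x ∷ xs) f g = trans (cong (f x + g x +_) (∑-+ xs f g)) (interchange (f x) (g x) _ _)

∑-*ʳ : ∀ (xs : List I) f c → ∑[ x ∈ xs ] (f x * c) ≡ ∑ xs f * c
∑-*ʳ []       f c = refl
∑-*ʳ (x ∷ xs) f c = trans (cong (f x * c +_) (∑-*ʳ xs f c)) (sym (*-distribʳ-+ c (f x) _))

∑-const : ∀ (xs : List I) v → ∑[ _ ∈ xs ] v ≡ length xs * v
∑-const []       v = refl
∑-const (x ∷ xs) v = cong (v +_) (∑-const xs v)

∑-zero : ∀ (xs : List I) → ∑[ _ ∈ xs ] 0 ≡ 0
∑-zero xs = trans (∑-const xs 0) (*-zeroʳ (length xs))

∑-cong : ∀ (xs : List I) {f g} → (∀ x → f x ≡ g x) → ∑ xs f ≡ ∑ xs g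
∑-cong []       f≡g = refl
∑-cong (x ∷ xs) f≡g = cong₂ _+_ (f≡g x) (∑-cong xs f≡g)

∑-mono-≤ : ∀ (xs : List I) {f g} → (∀ x → f x ≤ g x) → ∑ xs f ≤ ∑ xs g
∑-mono-≤ []       f≤g = z≤n
∑-mono-≤ (x ∷ xs) f≤g = +-mono-≤ (f≤g x) (∑-mono-≤ xs f≤g)

∑-mono-< : ∀ {xs : List I} {f g x} → (∀ y → f y ≤ g y) → x ∈ˡ xs → f x < g x → ∑ xs f < ∑ xs g
∑-mono-< {xs = _ ∷ xs} f≤g (here refl) fx<gx = +-mono-<-≤ fx<gx (∑-mono-≤ xs f≤g)
∑-mono-< {xs = y ∷ _}  f≤g (there x∈xs) fx<gx = +-mono-≤-< (f≤g y) (∑-mono-< f≤g x∈xs fx<gx)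

∑-≥-∈ : ∀ {xs : List I} f {x} → x ∈ˡ xs → f x ≤ ∑ xs f
∑-≥-∈ f (here refl)  = m≤m+n _ _
∑-≥-∈ f (there x∈xs) = ≤-trans (∑-≥-∈ f x∈xs) (m≤n+m _ _)

∑-comm : ∀ (xs : List I) (ys : List I′) (f : I → I′ → ℕ) →
         ∑[ x ∈ xs ] ∑ ys (f x) ≡ ∑[ y ∈ ys ] ∑[ x ∈ xs ] f x y
∑-comm []       ys f = sym (∑-zero ys)
∑-comm (x ∷ xs) ys f = trans (cong (∑ ys (f x) +_) (∑-comm xs ys f)) (sym (∑-+ ys (f x) _))

∑-comm-uniform : ∀ (xs : List I) (ys : List I′) {f : I → I′ → ℕ} {c v} →
                 (∀ y → (∑[ x ∈ xs ] f x y) * c ≡ v) → (∑[ x ∈ xs ] ∑ ys (f x)) * c ≡ length ys * v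
∑-comm-uniform xs ys {f} {c} {v} uniform = begin
  (∑[ x ∈ xs ] ∑ ys (f x)) * c        ≡⟨ cong (_* c) (∑-comm xs ys f) ⟩
  (∑[ y ∈ ys ] ∑[ x ∈ xs ] f x y) * c ≡⟨ sym (∑-*ʳ ys _ c) ⟩
  ∑[ y ∈ ys ] ((∑[ x ∈ xs ] f x y) * c) ≡⟨ ∑-cong ys uniform ⟩
  ∑[ _ ∈ ys ] v                       ≡⟨ ∑-const ys v ⟩
  length ys * v                       ∎
  where open ≡-Reasoning

𝟙 : ∀ {P : Set} → Dec P → ℕ
𝟙 d = if does d then 1 else 0

𝟙≤1 : ∀ {P : Set} (d : Dec P) → 𝟙 d ≤ 1
𝟙≤1 (yes _) = s≤s z≤n
𝟙≤1 (no _)  = z≤n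

𝟙+𝟙¬≡1 : ∀ {P : Set} (d : Dec P) → 𝟙 d + 𝟙 (¬? d) ≡ 1
𝟙+𝟙¬≡1 (yes _) = refl
𝟙+𝟙¬≡1 (no _)  = refl

𝟙¬≤ : ∀ {P : Set} {m} (d : Dec P) → (¬ P → 1 ≤ m) → 𝟙 (¬? d) ≤ m
𝟙¬≤ (yes _) _       = z≤n
𝟙¬≤ (no ¬p) ¬p⇒1≤m = ¬p⇒1≤m ¬p

length-filter≡∑𝟙 : ∀ {P : I → Set} (P? : ∀ x → Dec (P x)) xs → length (filter P? xs) ≡ ∑ xs (𝟙 ∘ P?)
length-filter≡∑𝟙 P? []       = refl
length-filter≡∑𝟙 P? (x ∷ xs) with does (P? x)
... | true  = cong suc (length-filter≡∑𝟙 P? xs)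
... | false = length-filter≡∑𝟙 P? xs

∈-allSubsets : ∀ {m} (X : Subset m) → X ∈ˡ allSubsets m
∈-allSubsets []          = here refl
∈-allSubsets (true ∷ X)  = ∈-++⁺ˡ (∈-map⁺ (true ∷_) (∈-allSubsets X))
∈-allSubsets (false ∷ X) = ∈-++⁺ʳ _ (∈-map⁺ (false ∷_) (∈-allSubsets X))

∑-allSubsets-suc : ∀ m (f : Subset (suc m) → ℕ) →
  ∑ (allSubsets (suc m)) f ≡ ∑ (allSubsets m) (f ∘ (true ∷_)) + ∑ (allSubsets m) (f ∘ (false ∷_))
∑-allSubsets-suc m f = trans (∑-++ (map (true ∷_) Xs) _ f) (cong₂ _+_ (∑-map _ Xs f) (∑-map _ Xs f))
  where Xs = allSubsets m

∑-allSubsets-1 : ∀ m → ∑[ _ ∈ allSubsets m ] 1 ≡ 2 ^ m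
∑-allSubsets-1 zero    = refl
∑-allSubsets-1 (suc m) =
  trans (∑-allSubsets-suc m _) (trans (cong₂ _+_ (∑-allSubsets-1 m) (∑-allSubsets-1 m))
                                      (cong (2 ^ m +_) (sym (+-identityʳ (2 ^ m)))))

Ignores : ∀ {m} → Fin m → (Subset m → ℕ) → Set
Ignores p R = ∀ X Y → (∀ q → q ≢ p → lookup X q ≡ lookup Y q) → R X ≡ R Y

∑-outside : ∀ m (p : Fin m) R → Ignores p R →
  2 * ∑[ X ∈ allSubsets m ] (if lookup X p then 0 else R X) ≡ ∑ (allSubsets m) R
∑-outside (suc m) Fin.zero R ignores = begin
  2 * ∑[ X ∈ allSubsets (suc m) ] (if lookup X Fin.zero then 0 else R X)
    ≡⟨ cong (2 *_) (trans (∑-allSubsets-suc m _) (cong (_+ ∑ Ys R₀) (∑-zero Ys))) ⟩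
  ∑ Ys R₀ + (∑ Ys R₀ + 0)  ≡⟨ cong (∑ Ys R₀ +_) (+-identityʳ _) ⟩
  ∑ Ys R₀ + ∑ Ys R₀        ≡⟨ cong (_+ ∑ Ys R₀) (∑-cong Ys flip) ⟩
  ∑ Ys R₁ + ∑ Ys R₀        ≡⟨ sym (∑-allSubsets-suc m R) ⟩
  ∑ (allSubsets (suc m)) R ∎
  where
  open ≡-Reasoning
  Ys = allSubsets m
  R₀ = R ∘ (false ∷_)
  R₁ = R ∘ (true ∷_)
  flip : ∀ Y → R₀ Y ≡ R₁ Y
  flip Y = ignores _ _ λ { Fin.zero q≢0 → contradiction refl q≢0 ; (Fin.suc q) _ → refl }
∑-outside (suc m) (Fin.suc p) R ignores = begin
  2 * ∑[ X ∈ allSubsets (suc m) ] (if lookup X (Fin.suc p) then 0 else R X)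
    ≡⟨ cong (2 *_) (∑-allSubsets-suc m _) ⟩
  2 * (S true + S false)                     ≡⟨ *-distribˡ-+ 2 (S true) (S false) ⟩
  2 * S true + 2 * S false
    ≡⟨ cong₂ _+_ (∑-outside m p _ (ignoresAfter true)) (∑-outside m p _ (ignoresAfter false)) ⟩
  ∑ Ys (R ∘ (true ∷_)) + ∑ Ys (R ∘ (false ∷_)) ≡⟨ sym (∑-allSubsets-suc m R) ⟩
  ∑ (allSubsets (suc m)) R                   ∎
  where
  open ≡-Reasoning
  Ys = allSubsets m
  S : Bool → ℕ
  S b = ∑[ Y ∈ Ys ] (if lookup Y p then 0 else R (b ∷ Y))
  ignoresAfter : ∀ b → Ignores p (R ∘ (b ∷_))
  ignoresAfter b X Y same = ignores _ _ λ { Fin.zero _ → refl ; (Fin.suc q) q≢p → same q (q≢p ∘ cong Fin.suc) }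

avoids : ∀ {m k} → (Fin k → Fin m) → Subset m → ℕ
avoids {k = zero}  g X = 1
avoids {k = suc k} g X = if lookup X (g Fin.zero) then 0 else avoids (g ∘ Fin.suc) X

avoids-cong : ∀ {m k} (g : Fin k → Fin m) {X Y} → (∀ t → lookup X (g t) ≡ lookup Y (g t)) →
              avoids g X ≡ avoids g Y
avoids-cong {k = zero}  g same = refl
avoids-cong {k = suc k} g same =
  cong₂ (λ b r → if b then 0 else r) (same Fin.zero) (avoids-cong (g ∘ Fin.suc) (same ∘ Fin.suc))

∉⇒lookup≡false : ∀ {m} {X : Subset m} {q} → q ∉ X → lookup X q ≡ false
∉⇒lookup≡false {X = X} {q} q∉X with lookup X q in eq
... | true  = contradiction (lookup⇒[]= q X eq) q∉X
... | false = refl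

avoids-outside : ∀ {m k} (g : Fin k → Fin m) {X} → (∀ t → g t ∉ X) → avoids g X ≡ 1
avoids-outside {k = zero}  g outside = refl
avoids-outside {k = suc k} g outside
  rewrite ∉⇒lookup≡false (outside Fin.zero) = avoids-outside (g ∘ Fin.suc) (outside ∘ Fin.suc)

-- Each of the k forbidden positions halves the count.
∑-avoids : ∀ m {k} (g : Fin k → Fin m) → Injective _≡_ _≡_ g →
           ∑ (allSubsets m) (avoids g) * 2 ^ k ≡ 2 ^ m
∑-avoids m {zero}  g injective = trans (*-identityʳ _) (∑-allSubsets-1 m)
∑-avoids m {suc k} g injective = begin
  S * (2 * 2 ^ k)  ≡⟨ sym (*-assoc S 2 (2 ^ k)) ⟩
  S * 2 * 2 ^ k    ≡⟨ cong (_* 2 ^ k) (*-comm S 2) ⟩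
  2 * S * 2 ^ k    ≡⟨ cong (_* 2 ^ k) (∑-outside m (g Fin.zero) _ ignoresHead) ⟩
  ∑ (allSubsets m) (avoids (g ∘ Fin.suc)) * 2 ^ k
                   ≡⟨ ∑-avoids m (g ∘ Fin.suc) (Finₚ.suc-injective ∘ injective) ⟩
  2 ^ m            ∎
  where
  open ≡-Reasoning
  S = ∑ (allSubsets m) (avoids g)
  ignoresHead : Ignores (g Fin.zero) (avoids (g ∘ Fin.suc))
  ignoresHead X Y same = avoids-cong (g ∘ Fin.suc) λ t → same _ (Finₚ.0≢1+n ∘ sym ∘ injective)

half : (k : ℕ) → Fin 2 → Fin k → Fin (side k)
half k Fin.zero    t = t ↑ˡ k
half k (Fin.suc _) t = k ↑ʳ t

half-InHalf : ∀ k h t → InHalf k h (half k h t)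
half-InHalf k Fin.zero    t rewrite toℕ-↑ˡ t k = toℕ<n t
half-InHalf k (Fin.suc _) t rewrite toℕ-↑ʳ k t = m≤m+n k (toℕ t)

half-injective : ∀ k h → Injective _≡_ _≡_ (half k h)
half-injective k Fin.zero    = ↑ˡ-injective k _ _
half-injective k (Fin.suc _) = ↑ʳ-injective k _ _

InHalf⇒half : ∀ k h (i : Fin (side k)) → InHalf k h i → ∃ λ t → half k h t ≡ i
InHalf⇒half k Fin.zero i i<k =
  fromℕ< i<k , toℕ-injective (trans (toℕ-↑ˡ (fromℕ< i<k) k) (toℕ-fromℕ< i<k))
InHalf⇒half k (Fin.suc _) i k≤i =
  fromℕ< i∸k<k , toℕ-injective (trans (toℕ-↑ʳ k _) (trans (cong (k +_) (toℕ-fromℕ< i∸k<k)) (m+[n∸m]≡n k≤i)))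
  where
  i∸k<k : toℕ i ∸ k < k
  i∸k<k = subst (toℕ i ∸ k <_) (m+n∸m≡n k k) (∸-monoˡ-< (toℕ<n i) k≤i)

cell-injective : ∀ k {i j i′ j′} → cell k i j ≡ cell k i′ j′ → i ≡ i′ × j ≡ j′
cell-injective k {i} {j} {i′} {j′} eq = let (j≡j′ , i≡i′) = combine-injective j i j′ i′ eq in i≡i′ , j≡j′

rowCells colCells : ∀ k → Fin 2 → Fin 2 → Fin k → Fin k → Fin (side k * side k)
rowCells k a b t s = cell k (half k b t) (half k a s)
colCells k a b t s = cell k (half k b s) (half k a t)

rowCells-injective : ∀ k a b t → Injective _≡_ _≡_ (rowCells k a b t)
rowCells-injective k a b t = half-injective k a ∘ proj₂ ∘ cell-injective k

colCells-injective : ∀ k a b t → Injective _≡_ _≡_ (colCells k a b t)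
colCells-injective k a b t = half-injective k b ∘ proj₁ ∘ cell-injective k

lineViolations : ∀ k → Fin 2 → Fin 2 → Fin k → Subset (side k * side k) → ℕ
lineViolations k a b t X = avoids (rowCells k a b t) X + avoids (colCells k a b t) X

violations : ∀ k → Subset (side k * side k) → ℕ
violations k X = ∑[ a ∈ allFin 2 ] ∑[ b ∈ allFin 2 ] ∑[ t ∈ allFin k ] lineViolations k a b t X

lineViolations≤violations : ∀ k a b t X → lineViolations k a b t X ≤ violations k X
lineViolations≤violations k a b t X =
  ≤-trans (∑-≥-∈ (line a b) (∈-allFin t))
  (≤-trans (∑-≥-∈ (λ b → ∑ (allFin k) (line a b)) (∈-allFin b))
           (∑-≥-∈ (λ a → ∑[ b ∈ allFin 2 ] ∑ (allFin k) (line a b)) (∈-allFin a)))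
  where
  line : Fin 2 → Fin 2 → Fin k → ℕ
  line a b t = lineViolations k a b t X

∑-violations : ∀ k →
  ∑ (allSubsets (side k * side k)) (violations k) * 2 ^ k ≡ 8 * k * 2 ^ (side k * side k)
∑-violations k = begin
  ∑ Xs (violations k) * 2 ^ k
    ≡⟨ ∑-comm-uniform Xs (allFin 2) (λ a → ∑-comm-uniform Xs (allFin 2) (λ b →
       ∑-comm-uniform Xs (allFin k) (λ t → ∑-lineViolations a b t))) ⟩
  2 * (2 * (length (allFin k) * (2 ^ n + 2 ^ n)))
    ≡⟨ cong (λ l → 2 * (2 * (l * (2 ^ n + 2 ^ n)))) (length-tabulate {n = k} id) ⟩
  2 * (2 * (k * (2 ^ n + 2 ^ n)))
    ≡⟨ solve 2 (λ k m → con 2 :* (con 2 :* (k :* (m :+ m))) := con 8 :* k :* m) refl k (2 ^ n) ⟩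
  8 * k * 2 ^ n ∎
  where
  open ≡-Reasoning
  open +-*-Solver
  n = side k * side k
  Xs = allSubsets n
  ∑-lineViolations : ∀ a b t → ∑ Xs (lineViolations k a b t) * 2 ^ k ≡ 2 ^ n + 2 ^ n
  ∑-lineViolations a b t =
    trans (cong (_* 2 ^ k) (∑-+ Xs _ _))
    (trans (*-distribʳ-+ (2 ^ k) (∑ Xs (avoids (rowCells k a b t))) (∑ Xs (avoids (colCells k a b t))))
           (cong₂ _+_ (∑-avoids n _ (rowCells-injective k a b t)) (∑-avoids n _ (colCells-injective k a b t))))

-- Ample k X unfolds to  ∀ a b → Covers k b a (λ i j → cell k i j ∈ X) × Covers k a b (λ j i → cell k i j ∈ X).
Covers : ∀ k → Fin 2 → Fin 2 → (Fin (side k) → Fin (side k) → Set) → Set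
Covers k r c P = (i : Fin (side k)) → InHalf k r i → ∃ λ j → InHalf k c j × P i j

coversRow? : ∀ k r c {P : Fin (side k) → Fin (side k) → Set} → (∀ i j → Dec (P i j)) →
             ∀ i → Dec (InHalf k r i → ∃ λ j → InHalf k c j × P i j)
coversRow? k r c P? i = InHalf? k r i →-dec any? λ j → InHalf? k c j ×-dec P? i j

covers? : ∀ k r c {P} → (∀ i j → Dec (P i j)) → Dec (Covers k r c P)
covers? k r c P? = all? (coversRow? k r c P?)

uncovered : ∀ k r c {P} → (∀ i j → Dec (P i j)) → ¬ Covers k r c P →
            ∃ λ t → ∀ s → ¬ P (half k r t) (half k c s)
uncovered k r c P? ¬covers with ¬∀⟶∃¬ _ _ (coversRow? k r c P?) ¬covers
... | i , ¬coversᵢ with InHalf? k r i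
...   | no  i∉r = contradiction (λ i∈r → contradiction i∈r i∉r) ¬coversᵢ
...   | yes i∈r with InHalf⇒half k r i i∈r
...     | t , refl = t , λ s p → ¬coversᵢ λ _ → half k c s , half-InHalf k c s , p

rowsCovered? : ∀ k X a b → Dec (Covers k b a λ i j → cell k i j ∈ X)
rowsCovered? k X a b = covers? k b a λ i j → cell k i j ∈? X

colsCovered? : ∀ k X a b → Dec (Covers k a b λ j i → cell k i j ∈ X)
colsCovered? k X a b = covers? k a b λ j i → cell k i j ∈? X

¬Ample⇒violation : ∀ k X → ¬ Ample k X → ∃ λ a → ∃ λ b → ∃ λ t → 1 ≤ lineViolations k a b t X
¬Ample⇒violation k X ¬ample
  with ¬∀⟶∃¬ 2 _ (λ a → all? λ b → rowsCovered? k X a b ×-dec colsCovered? k X a b) ¬ample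
... | a , ¬ampleₐ with ¬∀⟶∃¬ 2 _ (λ b → rowsCovered? k X a b ×-dec colsCovered? k X a b) ¬ampleₐ
...   | b , ¬ampleₐᵦ with rowsCovered? k X a b
...     | no ¬rows = let (t , empty) = uncovered k b a (λ i j → cell k i j ∈? X) ¬rows in
                     a , b , t , ≤-trans (≤-reflexive (sym (avoids-outside _ empty))) (m≤m+n _ _)
...     | yes rows = let (t , empty) = uncovered k a b (λ j i → cell k i j ∈? X) (¬ampleₐᵦ ∘ (rows ,_)) in
                     a , b , t , ≤-trans (≤-reflexive (sym (avoids-outside _ empty))) (m≤n+m _ _)

nonAmple≤violations : ∀ k X → 𝟙 (¬? (Ample? k X)) ≤ violations k X
nonAmple≤violations k X = 𝟙¬≤ (Ample? k X) λ ¬ample →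
  let (a , b , t , violated) = ¬Ample⇒violation k X ¬ample in
  ≤-trans violated (lineViolations≤violations k a b t X)

violations-∅ : ∀ k → Fin k → 2 ≤ violations k ∅
violations-∅ k t = ≤-trans (≤-reflexive (sym two)) (lineViolations≤violations k Fin.zero Fin.zero t ∅)
  where
  two : lineViolations k Fin.zero Fin.zero t ∅ ≡ 2
  two = cong₂ _+_ (avoids-outside (rowCells k Fin.zero Fin.zero t) λ _ → ∉⊥)
                  (avoids-outside (colCells k Fin.zero Fin.zero t) λ _ → ∉⊥)

mainTheorem3 : (k : ℕ) → 1 ≤ k →
    let n = side k * side k in
    2 ^ n * 2 ^ k < numAmple k * 2 ^ k + 8 * k * 2 ^ n
mainTheorem3 k 1≤k = begin-strict
  2 ^ n * c                      ≡⟨ cong (_* c) (sym ample+nonAmple) ⟩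
  (A + N) * c                    ≡⟨ *-distribʳ-+ c A N ⟩
  A * c + N * c                  <⟨ +-monoʳ-< (A * c) (*-monoˡ-< c {{m^n≢0 2 k}} N<V) ⟩
  A * c + V * c
    ≡⟨ cong₂ _+_ (cong (_* c) (sym (length-filter≡∑𝟙 (Ample? k) Xs))) (∑-violations k) ⟩
  numAmple k * c + 8 * k * 2 ^ n ∎
  where
  open ≤-Reasoning
  n = side k * side k
  c = 2 ^ k
  Xs = allSubsets n
  A = ∑ Xs (𝟙 ∘ Ample? k)
  N = ∑ Xs (𝟙 ∘ ¬? ∘ Ample? k)
  V = ∑ Xs (violations k)
  ample+nonAmple : A + N ≡ 2 ^ n
  ample+nonAmple = trans (sym (∑-+ Xs (𝟙 ∘ Ample? k) (𝟙 ∘ ¬? ∘ Ample? k)))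
                         (trans (∑-cong Xs (𝟙+𝟙¬≡1 ∘ Ample? k)) (∑-allSubsets-1 n))
  N<V : N < V
  N<V = ∑-mono-< (nonAmple≤violations k) (∈-allSubsets ∅)
                 (≤-trans (s≤s (𝟙≤1 (¬? (Ample? k ∅)))) (violations-∅ k (fromℕ< 1≤k)))
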